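{- Let $k\geq 2$ be an integer. If every graph with minimum degree $\delta\geq k^2$ and maximum degree $\Delta<2k^2$ has a $\frac{1}{k}$-majority $(k+1)$-edge-colouring, then every graph with minimum degree at least $k^2$ has a $\frac{1}{k}$-majority $(k+1)$-edge-colouring.
   Context: Graphs are finite and simple. For an integer $k\geq 2$, a $\frac{1}{k}$-majority $l$-edge-colouring of a graph $G$ is an assignment to each edge of $G$ of one of $l$ colours such that for every colour $i$ and every vertex $v$ of $G$, at most $\frac{d_G(v)}{k}$ of the edges incident with $v$ have colour $i$ (where $d_G(v)$ is the degree of $v$). -}

module Defs where

open import Data.Nat using (ℕ; _*_; _^_; _≤_; _<_)
open import Data.Bool using (Bool; true; false; _∧_)
open import Data.Fin using (Fin)
open import Data.Fin.Properties using (_≟_)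
open import Data.List using (List; length; filter)
open import Data.List.Base using (allFin)
open import Data.Product using (Σ; _×_; ∃)
open import Relation.Binary.PropositionalEquality using (_≡_)
open import Relation.Nullary.Decidable using (does)

record Graph (n : ℕ) : Set where
  field
    adj   : Fin n → Fin n → Bool
    sym   : ∀ u v → adj u v ≡ adj v u
    irrefl : ∀ v → adj v v ≡ false
open Graph public

neighbours : ∀ {n} → Graph n → Fin n → List (Fin n)
neighbours G v = filter (λ u → adj G v u ≡? true) (allFin _)
  where
  open import Data.Bool.Properties using () renaming (_≟_ to _≡?_)

degree : ∀ {n} → Graph n → Fin n → ℕ
degree G v = length (neighbours G v)

MinDegreeAtLeast : ∀ {n} → Graph n → ℕ → Set
MinDegreeAtLeast G d = ∀ v → d ≤ degree G v

MaxDegreeLessThan : ∀ {n} → Graph n → ℕ → Set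
MaxDegreeLessThan G d = ∀ v → degree G v < d

-- An l-edge-colouring: a colour for each unordered pair, given symmetrically;
-- only values on edges matter.
record EdgeColouring {n} (G : Graph n) (l : ℕ) : Set where
  field
    col    : Fin n → Fin n → Fin l
    colSym : ∀ u v → adj G u v ≡ true → col u v ≡ col v u
open EdgeColouring public

colourDegree : ∀ {n l} {G : Graph n} → EdgeColouring G l → Fin n → Fin l → ℕ
colourDegree {G = G} c v i =
  length (filter (λ u → col c v u ≟ i) (neighbours G v))

-- 1/k-majority: for every colour i and vertex v, #(edges at v of colour i) ≤ d(v)/k,
-- i.e. k * #(...) ≤ d(v)  (rational inequality cleared of denominators).
IsMajorityColouring : ∀ {n l} {G : Graph n} → ℕ → EdgeColouring G l → Set
IsMajorityColouring {G = G} k c = ∀ v i → k * colourDegree c v i ≤ degree G v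

HasMajorityColouring : ∀ {n} → Graph n → ℕ → ℕ → Set
HasMajorityColouring G k l = Σ (EdgeColouring G l) λ c → IsMajorityColouring k c

-- Splitting a vertex v of degree at least 2K: a new vertex takes over K of
-- the edges at v.  Every vertex still has degree at least K, and a
-- 1/k-majority colouring of the new graph is one of the old graph, because at
-- v both the colour degree and the degree are the sums of those at the two
-- halves.  The total excess  Σ_w (d(w) + 1 ∸ 2K)  strictly decreases, so
-- repeated splitting ends in a graph of maximum degree below 2K.

module Submission where

open import Defs renaming (sym to adj-sym)
open import Data.Nat using (ℕ; zero; suc; _+_; _*_; _^_; _∸_; _≤_; _<_; _≤?_; z≤n; s≤s)
open import Data.Nat.Properties
  using ( +-identityʳ; +-comm; +-mono-≤; +-mono-<-≤; +-mono-≤-<; *-distribˡ-+; +-cancelˡ-≤; +-monoˡ-≤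
        ; ≤-refl; ≤-reflexive; ≤-trans; ≤-pred; <⇒≤; <-≤-trans; ≰⇒>; m≤m+n; m<n+m
        ; ∸-monoˡ-<; m≤n⇒m∸n≡0; m<n⇒0<n∸m; m^n>0; +-0-commutativeMonoid; module ≤-Reasoning )
open import Data.Bool using (Bool; true; false; _∧_; _∨_; not; if_then_else_)
open import Data.Bool.Properties using (∧-assoc; ∧-identityʳ; ∧-zeroʳ; ∨-comm; ∨-identityʳ)
  renaming (_≟_ to _≟ᵇ_)
open import Data.Fin using (Fin; zero; suc)
open import Data.Fin.Properties using (_≟_; any?)
open import Data.List using (List; []; _∷_; length; filter; tabulate; allFin)
open import Data.Product using (∃; _×_; _,_; proj₁; proj₂)
open import Data.Vec.Functional using () renaming (_∷_ to _◂_)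
open import Function using (id; _∘_; case_of_)
open import Relation.Binary.PropositionalEquality
open import Relation.Nullary using (yes; no; contradiction)
open import Relation.Nullary.Decidable using (does; dec-true; dec-false)
open import Relation.Unary using (Pred; Decidable)
open import Relation.Unary.Properties using (_∩?_)
open import Algebra.Properties.CommutativeMonoid.Sum +-0-commutativeMonoid
  using (sum; sum-cong-≗; ∑-distrib-+; sum-replicate-zero)

indicator : Bool → ℕ
indicator true  = 1
indicator false = 0

count : ∀ {n} → (Fin n → Bool) → ℕ
count p = sum (indicator ∘ p)

sum-mono-≤ : ∀ {n} {f g : Fin n → ℕ} → (∀ u → f u ≤ g u) → sum f ≤ sum g
sum-mono-≤ {zero}  f≤g = z≤n
sum-mono-≤ {suc n} f≤g = +-mono-≤ (f≤g zero) (sum-mono-≤ (f≤g ∘ suc))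

sum-mono-< : ∀ {n} {f g : Fin n → ℕ} (v : Fin n) →
  (∀ u → f u ≤ g u) → f v < g v → sum f < sum g
sum-mono-< zero    f≤g fv<gv = +-mono-<-≤ fv<gv (sum-mono-≤ (f≤g ∘ suc))
sum-mono-< (suc v) f≤g fv<gv = +-mono-≤-< (f≤g zero) (sum-mono-< v (f≤g ∘ suc) fv<gv)

count-≟ : ∀ {n} (v : Fin n) b → count (λ u → does (u ≟ v) ∧ b) ≡ indicator b
count-≟ {suc n} zero b = trans (cong (indicator b +_) (sum-replicate-zero n)) (+-identityʳ _)
count-≟ (suc v) b = count-≟ v b

count-select : ∀ {n} (p : Fin n → Bool) m → m ≤ count p →
  ∃ λ q → (∀ u → q u ≡ true → p u ≡ true) × count q ≡ m
count-select {n} p zero _ = (λ _ → false) , (λ _ ()) , sum-replicate-zero n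
count-select {suc n} p (suc m) m<count with p zero in p₀
... | true  with q , q⊆p , #q ← count-select (p ∘ suc) m (≤-pred m<count) =
  true ◂ q , (λ { zero _ → p₀ ; (suc u) → q⊆p u }) , cong suc #q
... | false with q , q⊆p , #q ← count-select (p ∘ suc) (suc m) m<count =
  false ◂ q , (λ { zero () ; (suc u) → q⊆p u }) , #q

indicator-if : ∀ {A : Set} (f : A → Bool) (a m : Bool) (x y : A) → (m ≡ true → a ≡ true) →
  indicator (a ∧ f (if m then x else y)) ≡ indicator ((a ∧ not m) ∧ f y) + indicator (m ∧ f x)
indicator-if f a false x y _ rewrite ∧-identityʳ a = sym (+-identityʳ _)
indicator-if f a true  x y m⇒a rewrite m⇒a refl = refl

filter-filter : ∀ {a p q} {A : Set a} {P : Pred A p} {Q : Pred A q}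
  (P? : Decidable P) (Q? : Decidable Q) (xs : List A) →
  filter Q? (filter P? xs) ≡ filter (P? ∩? Q?) xs
filter-filter P? Q? [] = refl
filter-filter P? Q? (x ∷ xs) with does (P? x)
... | false = filter-filter P? Q? xs
... | true with does (Q? x)
...   | false = filter-filter P? Q? xs
...   | true  = cong (x ∷_) (filter-filter P? Q? xs)

length-filter-tabulate : ∀ {a p} {A : Set a} {P : Pred A p} (P? : Decidable P) {n} (f : Fin n → A) →
  length (filter P? (tabulate f)) ≡ count (λ u → does (P? (f u)))
length-filter-tabulate P? {zero}  f = refl
length-filter-tabulate P? {suc n} f with does (P? (f zero))
... | false = length-filter-tabulate P? (f ∘ suc)
... | true  = cong suc (length-filter-tabulate P? (f ∘ suc))

does-≟-true : ∀ b → does (b ≟ᵇ true) ≡ b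
does-≟-true false = refl
does-≟-true true  = refl

edgesAt : ∀ {n} → Graph n → (Fin n → Fin n → Bool) → Fin n → ℕ
edgesAt G R w = count (λ u → adj G w u ∧ R w u)

degree-count : ∀ {n} (G : Graph n) w → degree G w ≡ count (adj G w)
degree-count G w = trans (length-filter-tabulate (λ u → adj G w u ≟ᵇ true) id)
                         (sum-cong-≗ (cong indicator ∘ does-≟-true ∘ adj G w))

degree≡edgesAt : ∀ {n} (G : Graph n) w → degree G w ≡ edgesAt G (λ _ _ → true) w
degree≡edgesAt G w =
  trans (degree-count G w) (sum-cong-≗ (λ u → cong indicator (sym (∧-identityʳ (adj G w u)))))

colourDegree≡edgesAt : ∀ {n l} {G : Graph n} (c : EdgeColouring G l) w i →
  colourDegree c w i ≡ edgesAt G (λ x y → does (col c x y ≟ i)) w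
colourDegree≡edgesAt {G = G} c w i = begin
    length (filter (λ u → col c w u ≟ i) (neighbours G w))
  ≡⟨ cong length (filter-filter N? C? (allFin _)) ⟩
    length (filter (N? ∩? C?) (tabulate id))
  ≡⟨ length-filter-tabulate (N? ∩? C?) id ⟩
    count (λ u → does (adj G w u ≟ᵇ true) ∧ does (col c w u ≟ i))
  ≡⟨ sum-cong-≗ (λ u → cong (λ b → indicator (b ∧ _)) (does-≟-true (adj G w u))) ⟩
    edgesAt G (λ x y → does (col c x y ≟ i)) w
  ∎
  where
  open ≡-Reasoning
  N? = λ u → adj G w u ≟ᵇ true
  C? = λ u → col c w u ≟ i

module VertexSplit {n} (G : Graph n) (v : Fin n) (S : Fin n → Bool)
                   (S⊆N : ∀ u → S u ≡ true → adj G v u ≡ true) where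

  v∉S : S v ≡ false
  v∉S with S v in Sv
  ... | false = refl
  ... | true  = trans (sym (S⊆N v Sv)) (irrefl G v)

  moved : Fin n → Fin n → Bool
  moved w u = (does (w ≟ v) ∧ S u) ∨ (does (u ≟ v) ∧ S w)

  -- Vertex zero is the new vertex, suc w is the copy of w.
  splitAdj : Fin (suc n) → Fin (suc n) → Bool
  splitAdj zero    zero    = false
  splitAdj zero    (suc u) = S u
  splitAdj (suc w) zero    = S w
  splitAdj (suc w) (suc u) = adj G w u ∧ not (moved w u)

  split : Graph (suc n)
  split = record { adj = splitAdj ; sym = splitAdj-sym ; irrefl = splitAdj-irrefl }
    where
    splitAdj-sym : ∀ x y → splitAdj x y ≡ splitAdj y x
    splitAdj-sym zero    zero    = refl
    splitAdj-sym zero    (suc u) = refl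
    splitAdj-sym (suc w) zero    = refl
    splitAdj-sym (suc w) (suc u) =
      cong₂ (λ a b → a ∧ not b) (adj-sym G w u) (∨-comm (does (w ≟ v) ∧ S u) _)

    splitAdj-irrefl : ∀ x → splitAdj x x ≡ false
    splitAdj-irrefl zero    = refl
    splitAdj-irrefl (suc w) rewrite irrefl G w = refl

  -- The edge wu of G corresponds to the edge  end w u — end u w  of split.
  end : Fin n → Fin n → Fin (suc n)
  end w u = if does (w ≟ v) ∧ S u then zero else suc w

  alongSplit : ∀ {A : Set} → (Fin (suc n) → Fin (suc n) → A) → Fin n → Fin n → A
  alongSplit R w u = R (end w u) (end u w)

  moved-v : ∀ u → moved v u ≡ S u
  moved-v u rewrite dec-true (v ≟ v) refl | v∉S | ∧-zeroʳ (does (u ≟ v)) = ∨-identityʳ (S u)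

  moved-other : ∀ {w} → w ≢ v → ∀ u → moved w u ≡ does (u ≟ v) ∧ S w
  moved-other w≢v u rewrite dec-false (_ ≟ v) w≢v = refl

  adj-toward-v : ∀ w u → does (u ≟ v) ∧ S w ≡ true → adj G w u ≡ true
  adj-toward-v w u h with u ≟ v
  ... | yes refl = trans (adj-sym G w v) (S⊆N w h)

  splitAdj-end : ∀ w u → adj G w u ≡ true → splitAdj (end w u) (end u w) ≡ true
  splitAdj-end w u wu with w ≟ v | u ≟ v
  ... | yes refl | yes refl = contradiction (trans (sym wu) (irrefl G v)) λ ()
  ... | yes refl | no _ with S u in su
  ...   | true  = su
  ...   | false rewrite moved-v u | su | wu = refl
  splitAdj-end w u wu | no w≢v | yes refl with S w in sw
  ...   | true  = sw
  ...   | false rewrite moved-other w≢v v | sw | ∧-zeroʳ (does (v ≟ v)) | wu = refl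
  splitAdj-end w u wu | no w≢v | no u≢v rewrite moved-other w≢v u | dec-false (u ≟ v) u≢v | wu = refl

  edgesAt-other : ∀ (R : Fin (suc n) → Fin (suc n) → Bool) {w} → w ≢ v →
    edgesAt G (alongSplit R) w ≡ edgesAt split R (suc w)
  edgesAt-other R {w} w≢v = begin
    edgesAt G (alongSplit R) w                                   ≡⟨ sum-cong-≗ term ⟩
    sum (λ u → kept u + indicator (moved w u ∧ R (suc w) zero))  ≡⟨ ∑-distrib-+ kept _ ⟩
    sum kept + count (λ u → moved w u ∧ R (suc w) zero)          ≡⟨ cong (sum kept +_) movedCount ⟩
    sum kept + indicator (S w ∧ R (suc w) zero)                  ≡⟨ +-comm (sum kept) _ ⟩
    edgesAt split R (suc w)                                      ∎
    where
    open ≡-Reasoning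
    kept : Fin n → ℕ
    kept u = indicator ((adj G w u ∧ not (moved w u)) ∧ R (suc w) (suc u))

    term : ∀ u → indicator (adj G w u ∧ alongSplit R w u) ≡
                 kept u + indicator (moved w u ∧ R (suc w) zero)
    term u rewrite dec-false (w ≟ v) w≢v =
      indicator-if (R (suc w)) (adj G w u) _ zero (suc u) (adj-toward-v w u)

    movedCount : count (λ u → moved w u ∧ R (suc w) zero) ≡ indicator (S w ∧ R (suc w) zero)
    movedCount rewrite dec-false (w ≟ v) w≢v =
      trans (sum-cong-≗ (λ u → cong indicator (∧-assoc (does (u ≟ v)) (S w) _))) (count-≟ v _)

  edgesAt-v : ∀ (R : Fin (suc n) → Fin (suc n) → Bool) →
    edgesAt G (alongSplit R) v ≡ edgesAt split R zero + edgesAt split R (suc v)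
  edgesAt-v R = begin
    edgesAt G (alongSplit R) v                      ≡⟨ sum-cong-≗ term ⟩
    sum (λ u → kept u + taken u)                    ≡⟨ ∑-distrib-+ kept taken ⟩
    sum kept + sum taken                            ≡⟨ +-comm (sum kept) _ ⟩
    sum taken + sum kept
      ≡⟨ cong (λ b → sum taken + (indicator (b ∧ R (suc v) zero) + sum kept)) v∉S ⟨
    edgesAt split R zero + edgesAt split R (suc v)  ∎
    where
    open ≡-Reasoning
    kept taken : Fin n → ℕ
    kept u = indicator ((adj G v u ∧ not (moved v u)) ∧ R (suc v) (suc u))
    taken u = indicator (S u ∧ R zero (suc u))

    term : ∀ u → indicator (adj G v u ∧ alongSplit R v u) ≡ kept u + taken u
    term u rewrite dec-true (v ≟ v) refl | v∉S | ∧-zeroʳ (does (u ≟ v)) | ∨-identityʳ (S u) =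
      indicator-if (λ x → R x (suc u)) (adj G v u) (S u) zero (suc v) (S⊆N u)

  degree-split-other : ∀ {w} → w ≢ v → degree split (suc w) ≡ degree G w
  degree-split-other {w} w≢v = begin
    degree split (suc w)                       ≡⟨ degree≡edgesAt split (suc w) ⟩
    edgesAt split (λ _ _ → true) (suc w)       ≡⟨ edgesAt-other (λ _ _ → true) w≢v ⟨
    edgesAt G (λ _ _ → true) w                 ≡⟨ degree≡edgesAt G w ⟨
    degree G w                                 ∎
    where open ≡-Reasoning

  degree-split-v : degree G v ≡ degree split zero + degree split (suc v)
  degree-split-v = begin
    degree G v                                 ≡⟨ degree≡edgesAt G v ⟩
    edgesAt G (λ _ _ → true) v                 ≡⟨ edgesAt-v (λ _ _ → true) ⟩
    edgesAt split (λ _ _ → true) zero + edgesAt split (λ _ _ → true) (suc v)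
      ≡⟨ cong₂ _+_ (degree≡edgesAt split zero) (degree≡edgesAt split (suc v)) ⟨
    degree split zero + degree split (suc v)   ∎
    where open ≡-Reasoning

  liftColouring : ∀ {l} → EdgeColouring split l → EdgeColouring G l
  liftColouring c = record
    { col    = alongSplit (col c)
    ; colSym = λ w u wu → colSym c (end w u) (end u w) (splitAdj-end w u wu)
    }

  module _ {l} (c : EdgeColouring split l) (i : Fin l) where

    colourDegree-lift-other : ∀ {w} → w ≢ v →
      colourDegree (liftColouring c) w i ≡ colourDegree c (suc w) i
    colourDegree-lift-other {w} w≢v = begin
      colourDegree (liftColouring c) w i    ≡⟨ colourDegree≡edgesAt (liftColouring c) w i ⟩
      edgesAt G (alongSplit colourIs) w     ≡⟨ edgesAt-other colourIs w≢v ⟩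
      edgesAt split colourIs (suc w)        ≡⟨ colourDegree≡edgesAt c (suc w) i ⟨
      colourDegree c (suc w) i              ∎
      where open ≡-Reasoning
            colourIs = λ x y → does (col c x y ≟ i)

    colourDegree-lift-v :
      colourDegree (liftColouring c) v i ≡ colourDegree c zero i + colourDegree c (suc v) i
    colourDegree-lift-v = begin
      colourDegree (liftColouring c) v i    ≡⟨ colourDegree≡edgesAt (liftColouring c) v i ⟩
      edgesAt G (alongSplit colourIs) v     ≡⟨ edgesAt-v colourIs ⟩
      edgesAt split colourIs zero + edgesAt split colourIs (suc v)
        ≡⟨ cong₂ _+_ (colourDegree≡edgesAt c zero i) (colourDegree≡edgesAt c (suc v) i) ⟨
      colourDegree c zero i + colourDegree c (suc v) i ∎
      where open ≡-Reasoning
            colourIs = λ x y → does (col c x y ≟ i)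

  module _ {k l} {c : EdgeColouring split l} (maj : IsMajorityColouring k c) where
    open ≤-Reasoning

    liftColouring-isMajority-other : ∀ {w} → w ≢ v → ∀ i →
      k * colourDegree (liftColouring c) w i ≤ degree G w
    liftColouring-isMajority-other {w} w≢v i = begin
      k * colourDegree (liftColouring c) w i  ≡⟨ cong (k *_) (colourDegree-lift-other c i w≢v) ⟩
      k * colourDegree c (suc w) i            ≤⟨ maj (suc w) i ⟩
      degree split (suc w)                    ≡⟨ degree-split-other w≢v ⟩
      degree G w                              ∎

    liftColouring-isMajority-v : ∀ i → k * colourDegree (liftColouring c) v i ≤ degree G v
    liftColouring-isMajority-v i = begin
      k * colourDegree (liftColouring c) v i
        ≡⟨ cong (k *_) (colourDegree-lift-v c i) ⟩
      k * (colourDegree c zero i + colourDegree c (suc v) i)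
        ≡⟨ *-distribˡ-+ k _ _ ⟩
      k * colourDegree c zero i + k * colourDegree c (suc v) i
        ≤⟨ +-mono-≤ (maj zero i) (maj (suc v) i) ⟩
      degree split zero + degree split (suc v)
        ≡⟨ degree-split-v ⟨
      degree G v                              ∎

    liftColouring-isMajority : IsMajorityColouring k (liftColouring c)
    liftColouring-isMajority w i = case w ≟ v of λ where
      (no w≢v)   → liftColouring-isMajority-other w≢v i
      (yes refl) → liftColouring-isMajority-v i

m∸o<n∸o : ∀ {m n o} → m < n → o < n → m ∸ o < n ∸ o
m∸o<n∸o {m} {n} {o} m<n o<n with o ≤? m
... | yes o≤m = ∸-monoˡ-< m<n o≤m
... | no  o≰m = subst (_< n ∸ o) (sym (m≤n⇒m∸n≡0 (<⇒≤ (≰⇒> o≰m)))) (m<n⇒0<n∸m o<n)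

-- positive exactly at the vertices of degree at least 2K
excess : ℕ → ∀ {n} → Graph n → Fin n → ℕ
excess K G w = suc (degree G w) ∸ 2 * K

totalExcess : ℕ → ∀ {n} → Graph n → ℕ
totalExcess K G = sum (excess K G)

splitHighDegreeVertex : ∀ {K n} (G : Graph n) → 1 ≤ K → MinDegreeAtLeast G K →
  (v : Fin n) → 2 * K ≤ degree G v →
  ∃ λ (H : Graph (suc n)) → MinDegreeAtLeast H K × totalExcess K H < totalExcess K G ×
    (∀ {k l} → HasMajorityColouring H k l → HasMajorityColouring G k l)
splitHighDegreeVertex {K} G K≥1 δ v high =
  split , δ-split , totalExcess-split , λ {k} → liftMajority {k}
  where
  selection = count-select (adj G v) K
    (≤-trans (m≤m+n K (K + 0)) (subst (2 * K ≤_) (degree-count G v) high))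
  S = proj₁ selection
  open VertexSplit G v S (proj₁ (proj₂ selection))

  liftMajority : ∀ {k l} → HasMajorityColouring split k l → HasMajorityColouring G k l
  liftMajority {k} (c , maj) = liftColouring c , liftColouring-isMajority {k} {c = c} maj

  degree-zero : degree split zero ≡ K
  degree-zero = trans (degree-count split zero) (proj₂ (proj₂ selection))

  degree-v : degree G v ≡ K + degree split (suc v)
  degree-v = trans degree-split-v (cong (_+ degree split (suc v)) degree-zero)

  K≤degree-split-v : K ≤ degree split (suc v)
  K≤degree-split-v = +-cancelˡ-≤ K K _ (begin
    K + K                       ≡⟨ cong (K +_) (+-identityʳ K) ⟨
    2 * K                       ≤⟨ high ⟩
    degree G v                  ≡⟨ degree-v ⟩
    K + degree split (suc v)    ∎)
    where open ≤-Reasoning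

  δ-split : MinDegreeAtLeast split K
  δ-split zero    = ≤-reflexive (sym degree-zero)
  δ-split (suc w) = case w ≟ v of λ where
    (no w≢v)   → subst (K ≤_) (sym (degree-split-other w≢v)) (δ w)
    (yes refl) → K≤degree-split-v

  excess-split-zero : excess K split zero ≡ 0
  excess-split-zero rewrite degree-zero | +-identityʳ K = m≤n⇒m∸n≡0 (+-monoˡ-≤ K K≥1)

  excess-split-v : excess K split (suc v) < excess K G v
  excess-split-v = m∸o<n∸o
    (s≤s (subst (degree split (suc v) <_) (sym degree-v) (m<n+m _ K≥1)))
    (s≤s high)

  excess-split-suc : ∀ w → excess K split (suc w) ≤ excess K G w
  excess-split-suc w = case w ≟ v of λ where
    (no w≢v)   → ≤-reflexive (cong (λ d → suc d ∸ 2 * K) (degree-split-other w≢v))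
    (yes refl) → <⇒≤ excess-split-v

  totalExcess-split : totalExcess K split < totalExcess K G
  totalExcess-split = begin-strict
    totalExcess K split           ≡⟨ cong (_+ sum (excess K split ∘ suc)) excess-split-zero ⟩
    sum (excess K split ∘ suc)    <⟨ sum-mono-< v excess-split-suc excess-split-v ⟩
    totalExcess K G               ∎
    where open ≤-Reasoning

boundedDegreeSuffices : ∀ {k l K} → 1 ≤ K →
  (∀ n (G : Graph n) → MinDegreeAtLeast G K → MaxDegreeLessThan G (2 * K) →
    HasMajorityColouring G k l) →
  ∀ n (G : Graph n) → MinDegreeAtLeast G K → HasMajorityColouring G k l
boundedDegreeSuffices {k} {l} {K} K≥1 bounded n G = go (suc (totalExcess K G)) G ≤-refl
  where
  go : ∀ fuel {n} (G : Graph n) → totalExcess K G < fuel →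
    MinDegreeAtLeast G K → HasMajorityColouring G k l
  go (suc fuel) G μ<fuel δ with any? (λ w → 2 * K ≤? degree G w)
  ... | no noHighVertex = bounded _ G δ (λ w → ≰⇒> (noHighVertex ∘ (w ,_)))
  ... | yes (v , high) with splitHighDegreeVertex G K≥1 δ v high
  ...   | H , δH , μH<μG , lift = lift {k = k} (go fuel H (<-≤-trans μH<μG (≤-pred μ<fuel)) δH)

mainTheorem8 : (k : ℕ) → 2 ≤ k →
    (∀ (n : ℕ) (G : Graph n) → MinDegreeAtLeast G (k ^ 2) → MaxDegreeLessThan G (2 * k ^ 2) →
      HasMajorityColouring G k (k + 1)) →
    ∀ (n : ℕ) (G : Graph n) → MinDegreeAtLeast G (k ^ 2) → HasMajorityColouring G k (k + 1)
mainTheorem8 k@(suc _) _ = boundedDegreeSuffices {k} (m^n>0 k 2)
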